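{- Let $X$ be a mixed graph whose underlying graph is bipartite with a unique perfect matching $\mathcal{M}$, let $\alpha$ be a complex number with $|\alpha|=1$, and let $H_\alpha$ be the $\alpha$-hermitian adjacency matrix of $X$. For vertices $i,j$ let $\Im_{i\to j}$ be the set of co-augmenting mixed paths from $i$ to $j$. Then \[(H_\alpha^{ -1})_{ij}=\begin{cases}\displaystyle\sum_{P_{i\to j}\in\Im_{i\to j}}(-1)^{\frac{|E(P_{i\to j})|-1}{2}}\,h_\alpha(P_{i\to j}) & \text{if } i\neq j,\\ 0 & \text{if } i=j.\end{cases}\]
   Context: A mixed graph $X$ consists of a finite vertex set $V(X)$, a set $E_0(X)$ of undirected edges (digons) and a set $E_1(X)$ of directed edges (arcs), with no loops and at most one digon or arc between any two distinct vertices; its underlying graph $\Gamma(X)$ forgets orientations, and perfect matchings of $X$ are those of $\Gamma(X)$. For $|\alpha|=1$, $H_\alpha(X)=[h_{uv}]$ has $h_{uv}=1$ if $uv\in E_0(X)$, $h_{uv}=\alpha$ if $uv\in E_1(X)$ (arc from $u$ to $v$), $h_{uv}=\overline{\alpha}$ if $vu\in E_1(X)$, and $h_{uv}=0$ otherwise. A mixed path $P$ from $i$ to $j$ is a path $i=r_1,r_2,\dots,r_k=j$ in $\Gamma(X)$; $|E(P)|=k-1$ and $h_\alpha(P)=h_{r_1r_2}h_{r_2r_3}\cdots h_{r_{k-1}r_k}$. Such a path is co-augmenting if its edges alternate between edges of $\mathcal{M}$ and edges not in $\mathcal{M}$, with the first and last edges in $\mathcal{M}$. An empty sum is $0$. 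-}

module Defs where

open import Level using (_⊔_)
open import Data.Bool using (Bool; true; false; _∧_; _∨_; not; if_then_else_)
open import Data.Nat using (ℕ; zero; suc; _∸_; ⌊_/2⌋)
open import Data.Fin using (Fin; zero; suc)
import Data.Fin as Fin
open import Data.List using (List; []; _∷_; foldr; map; concatMap; allFin)
open import Data.Bool.ListAction using (any)
open import Data.Vec using (Vec; toList)
import Data.Vec as Vec
open import Data.Product using (Σ; _×_; _,_)
open import Relation.Binary.PropositionalEquality using (_≡_; _≢_)
open import Relation.Nullary.Decidable using (isYes)
open import Algebra.Bundles using (CommutativeRing)

-- Mixed graphs on the vertex set Fin n.
--   dig u v = true  : there is a digon (undirected edge) uv
--   arc u v = true  : there is an arc from u to v
-- No loops, and at most one digon or arc between two distinct vertices.

record MixedGraph (n : ℕ) : Set where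
  field
    dig      : Fin n → Fin n → Bool
    arc      : Fin n → Fin n → Bool
    dig-sym  : ∀ u v → dig u v ≡ dig v u
    dig-irr  : ∀ u → dig u u ≡ false
    arc-irr  : ∀ u → arc u u ≡ false
    arc-asym : ∀ u v → arc u v ≡ true → arc v u ≡ false
    dig-arc  : ∀ u v → dig u v ≡ true → arc u v ≡ false

  adj : Fin n → Fin n → Bool
  adj u v = dig u v ∨ (arc u v ∨ arc v u)

open MixedGraph public

IsBipartite : ∀ {n} → MixedGraph n → Set
IsBipartite {n} X = Σ (Fin n → Bool) λ c → ∀ u v → adj X u v ≡ true → c u ≢ c v

-- A perfect matching of Γ(X), given by the partner map m
-- (m u = v  iff  uv is a matching edge): a fixed-point-free involution
-- along edges of Γ(X).
IsPerfectMatching : ∀ {n} → MixedGraph n → (Fin n → Fin n) → Set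
IsPerfectMatching {n} X m =
  (∀ u → m (m u) ≡ u) × (∀ u → m u ≢ u) × (∀ u → adj X u (m u) ≡ true)

IsUniquePerfectMatching : ∀ {n} → MixedGraph n → (Fin n → Fin n) → Set
IsUniquePerfectMatching {n} X m =
  IsPerfectMatching X m × (∀ m' → IsPerfectMatching X m' → ∀ u → m' u ≡ m u)

-- Unit-modulus elements of a commutative ring with conjugation
-- (ℂ with complex conjugation is the intended instance).

record Conjugation {c ℓ} (R : CommutativeRing c ℓ) : Set (c ⊔ ℓ) where
  open CommutativeRing R using (Carrier; _≈_; _+_; _*_; -_; 0#; 1#)
  field
    conj         : Carrier → Carrier
    conj-cong    : ∀ {x y} → x ≈ y → conj x ≈ conj y
    conj-+       : ∀ x y → conj (x + y) ≈ conj x + conj y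
    conj-*       : ∀ x y → conj (x * y) ≈ conj x * conj y
    conj-1       : conj 1# ≈ 1#
    conj-involutive : ∀ x → conj (conj x) ≈ x

module _ {c ℓ} (R : CommutativeRing c ℓ) where
  open CommutativeRing R using (Carrier; _≈_; _+_; _*_; -_; 0#; 1#)

  sumList : List Carrier → Carrier
  sumList = foldr _+_ 0#

  sumFin : ∀ n → (Fin n → Carrier) → Carrier
  sumFin zero    f = 0#
  sumFin (suc n) f = f zero + sumFin n (λ i → f (suc i))

  neg1^ : ℕ → Carrier
  neg1^ zero    = 1#
  neg1^ (suc k) = - neg1^ k

  -- the α-hermitian adjacency matrix H_α(X); ᾱ is the conjugate of α
  Hα : ∀ {n} → MixedGraph n → (α ᾱ : Carrier) → Fin n → Fin n → Carrier
  Hα X α ᾱ u v =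
    if dig X u v then 1#
    else if arc X u v then α
    else if arc X v u then ᾱ
    else 0#

  IsRightInverse : ∀ {n} → (A B : Fin n → Fin n → Carrier) → Set ℓ
  IsRightInverse {n} A B = ∀ i j →
    sumFin n (λ k → A i k * B k j) ≈ (if isYes (i Fin.≟ j) then 1# else 0#)

  hPath : ∀ {n} → (Fin n → Fin n → Carrier) → List (Fin n) → Carrier
  hPath h (x ∷ y ∷ rest) = h x y * hPath h (y ∷ rest)
  hPath h _              = 1#

_⇔ᵇ_ : Bool → Bool → Bool
true  ⇔ᵇ c = c
false ⇔ᵇ c = not c

module _ {n : ℕ} where

  _==_ : Fin n → Fin n → Bool
  x == y = isYes (x Fin.≟ y)

  distinct : List (Fin n) → Bool
  distinct []       = true
  distinct (x ∷ xs) = not (any (x ==_) xs) ∧ distinct xs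

  isWalk : MixedGraph n → List (Fin n) → Bool
  isWalk X (x ∷ y ∷ rest) = adj X x y ∧ isWalk X (y ∷ rest)
  isWalk X _              = true

  -- edges alternate in / not in M, starting and ending with an edge of M
  -- (the Bool is whether the next edge must be in M)
  altM : (Fin n → Fin n) → Bool → List (Fin n) → Bool
  altM M b (x ∷ y ∷ rest) = ((M x == y) ⇔ᵇ b) ∧ altM M (not b) (y ∷ rest)
  altM M b (x ∷ [])        = not b
  altM M b []              = false

  allVecs : (k : ℕ) → List (Vec (Fin n) k)
  allVecs zero    = Vec.[] ∷ []
  allVecs (suc k) = concatMap (λ x → map (x Vec.∷_) (allVecs k)) (allFin n)

  isCoAugPath : MixedGraph n → (Fin n → Fin n) → Fin n → Fin n → ∀ {k} → Vec (Fin n) (suc k) → Bool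
  isCoAugPath X M i j P =
    (Vec.head P == i) ∧ (Vec.last P == j) ∧ distinct (toList P)
    ∧ isWalk X (toList P) ∧ altM M true (toList P)

module _ {c ℓ} (R : CommutativeRing c ℓ) where
  open CommutativeRing R using (Carrier; _≈_; _+_; _*_; -_; 0#; 1#)

  -- Σ_{P ∈ ℑ_{i→j}} (-1)^{(|E(P)|-1)/2} h_α(P); paths have k edges, k < n
  coAugSum : ∀ {n} → MixedGraph n → (Fin n → Fin n) → (α ᾱ : Carrier) → Fin n → Fin n → Carrier
  coAugSum {n} X M α ᾱ i j =
    sumFin R n λ k →
      sumList R (map (λ P → if isCoAugPath X M i j P
                              then neg1^ R ⌊ Fin.toℕ k ∸ 1 /2⌋ * hPath R (Hα R X α ᾱ) (toList P)
                              else 0#)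
                     (allVecs (suc (Fin.toℕ k))))

  Bmat : ∀ {n} → MixedGraph n → (Fin n → Fin n) → (α ᾱ : Carrier) → Fin n → Fin n → Carrier
  Bmat X M α ᾱ i j = if i == j then 0# else coAugSum X M α ᾱ i j

module Submission where

-- Expanding (H B)ᵢⱼ = Σₖ hᵢₖ Bₖⱼ gives a signed sum over co-augmenting paths Q from a neighbour k
-- of i to j, weighted by hᵢₖ. If Q avoids i, prefixing the matching edge (M i, i) yields a
-- co-augmenting path from M i that is two edges longer, has the opposite sign, and is weighted by
-- hᵢ,Mᵢ h_Mᵢ,ᵢ = 1, so the two terms cancel. If Q passes through i, it must start with exactly that
-- edge: otherwise Q and the edge ki close an even M-alternating cycle (bipartiteness), and switching M
-- along it gives a second perfect matching. The only uncancelled term is the path (M i, i), which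
-- contributes δᵢⱼ. The diagonal of B is consistent with the path sum because no co-augmenting path
-- returns to its start, and B H = I is H B = I for the transposed graph, whose co-augmenting paths are
-- the reversed ones.

open import Defs
open import Data.Bool using (Bool; true; false; _∧_; _∨_; not; if_then_else_)
import Data.Bool as Bool
open import Data.Bool.Properties using (∨-comm; ¬-not; ⇔→≡)
open import Data.Bool.ListAction using (any)
open import Data.Empty using (⊥-elim)
open import Data.Nat using (ℕ; zero; suc; _∸_; ⌊_/2⌋; _≤_; z≤n; s≤s)
import Data.Nat.Properties as ℕ
open import Data.Fin using (Fin; zero; suc; toℕ; punchIn; punchOut)
import Data.Fin as Fin
open import Data.Fin.Properties using (punchInᵢ≢i; punchOut-injective)
open import Data.List using (List; []; _∷_; _++_; _ʳ++_; map; concatMap; allFin; tabulate; length)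
import Data.List as List
import Data.List.Properties as List
open import Data.List.Membership.Propositional using (_∈_; _∉_)
open import Data.List.Relation.Unary.Any using (here; there)
open import Data.List.Relation.Unary.All using (All; []; _∷_)
import Data.List.Relation.Unary.All as All
import Data.List.Relation.Unary.All.Properties as All
open import Data.List.Relation.Unary.AllPairs as AllPairs using ()
open import Data.List.Relation.Unary.Linked as Linked using (Linked; []; [-]; _∷_)
open import Data.List.Relation.Unary.Unique.Propositional using (Unique; []; _∷_)
import Data.List.Relation.Binary.Permutation.Setoid as Permutation
import Data.List.Relation.Binary.Permutation.Setoid.Properties as PermutationProperties
open import Data.Vec using (Vec; []; _∷_; _∷ʳ_; head; last; toList; reverse)
import Data.Vec.Properties as Vec
open import Data.Product using (_×_; _,_; proj₁; proj₂; ∃; ∃₂)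
open import Function using (_∘_)
open import Function.Bundles using (mk⇔)
open import Relation.Nullary using (¬_; Dec; yes; no; _×-dec_)
open import Relation.Nullary.Decidable using (isYes; map′; isYes≗does; dec-true; dec-false)
open import Relation.Binary.Definitions using (Symmetric)
open import Relation.Binary.PropositionalEquality as ≡ using (_≡_; _≢_)
open import Algebra.Bundles using (CommutativeRing)

module FiniteSums {c ℓ} (R : CommutativeRing c ℓ) where

  open CommutativeRing R hiding (zero)
  open import Algebra.Properties.Semiring.Sum semiring public
  open import Algebra.Solver.CommutativeMonoid +-commutativeMonoid using (solve; _⊕_; _⊜_)
  open import Relation.Binary.Reasoning.Setoid setoid

  sumFin≡sum : ∀ n (f : Fin n → Carrier) → sumFin R n f ≡ sum f
  sumFin≡sum zero    f = ≡.refl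
  sumFin≡sum (suc n) f = ≡.cong (f zero +_) (sumFin≡sum n (f ∘ suc))

  sum-zero : ∀ n → ∑[ _ < n ] 0# ≈ 0#
  sum-zero = sum-replicate-zero

  sum-single : ∀ {n} (f : Fin n → Carrier) k → (∀ i → i ≢ k → f i ≈ 0#) → sum f ≈ f k
  sum-single {suc n} f k f≈0 = begin
    sum f                                ≈⟨ sum-remove f ⟩
    f k + ∑[ j < n ] f (punchIn k j)     ≈⟨ +-congˡ (sum-cong-≋ {n} λ j → f≈0 _ (punchInᵢ≢i k j)) ⟩
    f k + ∑[ _ < n ] 0#                  ≈⟨ +-congˡ (sum-zero n) ⟩
    f k + 0#                             ≈⟨ +-identityʳ (f k) ⟩
    f k                                  ∎

  sumList-++ : ∀ xs ys → sumList R (xs ++ ys) ≈ sumList R xs + sumList R ys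
  sumList-++ []       ys = sym (+-identityˡ _)
  sumList-++ (x ∷ xs) ys = trans (+-congˡ (sumList-++ xs ys)) (sym (+-assoc _ _ _))

  sumList-concatMap : ∀ {A B : Set} (f : B → Carrier) (g : A → List B) xs →
    sumList R (map f (concatMap g xs)) ≈ sumList R (map (λ x → sumList R (map f (g x))) xs)
  sumList-concatMap f g []       = refl
  sumList-concatMap f g (x ∷ xs) = begin
    sumList R (map f (g x ++ concatMap g xs))             ≡⟨ ≡.cong (sumList R) (List.map-++ f (g x) _) ⟩
    sumList R (map f (g x) ++ map f (concatMap g xs))     ≈⟨ sumList-++ (map f (g x)) _ ⟩
    sumList R (map f (g x)) + sumList R (map f (concatMap g xs)) ≈⟨ +-congˡ (sumList-concatMap f g xs) ⟩
    sumList R (map (λ x → sumList R (map f (g x))) (x ∷ xs)) ∎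

  sumList-allFin : ∀ n (f : Fin n → Carrier) → sumList R (map f (allFin n)) ≡ sum f
  sumList-allFin n f = ≡.trans (≡.cong (sumList R) (List.map-tabulate (λ i → i) f)) (tabulate-sum n f)
    where
    tabulate-sum : ∀ m (g : Fin m → Carrier) → sumList R (tabulate g) ≡ sum g
    tabulate-sum zero    g = ≡.refl
    tabulate-sum (suc m) g = ≡.cong (g zero +_) (tabulate-sum m (g ∘ suc))

  module _ {n : ℕ} where

    sumVecs : ∀ m → (Vec (Fin n) m → Carrier) → Carrier
    sumVecs zero    f = f []
    sumVecs (suc m) f = ∑[ x < n ] sumVecs m (λ v → f (x ∷ v))

    sumList-allVecs : ∀ m (f : Vec (Fin n) m → Carrier) → sumList R (map f (allVecs m)) ≈ sumVecs m f
    sumList-allVecs zero    f = +-identityʳ (f [])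
    sumList-allVecs (suc m) f = begin
      sumList R (map f (allVecs (suc m)))
        ≈⟨ sumList-concatMap f (λ x → map (x ∷_) (allVecs m)) (allFin n) ⟩
      sumList R (map (λ x → sumList R (map f (map (x ∷_) (allVecs m)))) (allFin n))
        ≡⟨ sumList-allFin n _ ⟩
      ∑[ x < n ] sumList R (map f (map (x ∷_) (allVecs m)))
        ≡⟨ sum-cong-≗ {n} (λ x → ≡.cong (sumList R) (≡.sym (List.map-∘ (allVecs m)))) ⟩
      ∑[ x < n ] sumList R (map (λ v → f (x ∷ v)) (allVecs m))
        ≈⟨ sum-cong-≋ {n} (λ x → sumList-allVecs m (λ v → f (x ∷ v))) ⟩
      sumVecs (suc m) f ∎

    sumVecs-cong : ∀ m {f g : Vec (Fin n) m → Carrier} → (∀ v → f v ≈ g v) → sumVecs m f ≈ sumVecs m g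
    sumVecs-cong zero    f≈g = f≈g []
    sumVecs-cong (suc m) f≈g = sum-cong-≋ {n} λ x → sumVecs-cong m (λ v → f≈g (x ∷ v))

    sumVecs-zero : ∀ m → sumVecs m (λ _ → 0#) ≈ 0#
    sumVecs-zero zero    = refl
    sumVecs-zero (suc m) = trans (sum-cong-≋ {n} λ _ → sumVecs-zero m) (sum-zero n)

    sumVecs-distrib-+ : ∀ m (f g : Vec (Fin n) m → Carrier) →
      sumVecs m (λ v → f v + g v) ≈ sumVecs m f + sumVecs m g
    sumVecs-distrib-+ zero    f g = refl
    sumVecs-distrib-+ (suc m) f g =
      trans (sum-cong-≋ {n} λ x → sumVecs-distrib-+ m (f ∘ (x ∷_)) (g ∘ (x ∷_)))
            (∑-distrib-+ (λ x → sumVecs m (f ∘ (x ∷_))) (λ x → sumVecs m (g ∘ (x ∷_))))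

    *-distribˡ-sumVecs : ∀ m a (f : Vec (Fin n) m → Carrier) → a * sumVecs m f ≈ sumVecs m (λ v → a * f v)
    *-distribˡ-sumVecs zero    a f = refl
    *-distribˡ-sumVecs (suc m) a f =
      trans (*-distribˡ-sum a (λ x → sumVecs m (f ∘ (x ∷_))))
            (sum-cong-≋ {n} λ x → *-distribˡ-sumVecs m a (f ∘ (x ∷_)))

    sumVecs-∑-comm : ∀ m {p} (f : Fin p → Vec (Fin n) m → Carrier) →
      sumVecs m (λ v → ∑[ k < p ] f k v) ≈ ∑[ k < p ] sumVecs m (f k)
    sumVecs-∑-comm zero    f = refl
    sumVecs-∑-comm (suc m) f =
      trans (sum-cong-≋ {n} λ x → sumVecs-∑-comm m (λ k v → f k (x ∷ v)))
            (∑-comm (λ x k → sumVecs m (λ v → f k (x ∷ v))))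

    sumVecs-single : ∀ m (f : Vec (Fin n) (suc m) → Carrier) x₀ →
      (∀ x v → x ≢ x₀ → f (x ∷ v) ≈ 0#) → sumVecs (suc m) f ≈ sumVecs m (λ v → f (x₀ ∷ v))
    sumVecs-single m f x₀ f≈0 =
      sum-single _ x₀ λ x x≢x₀ → trans (sumVecs-cong m λ v → f≈0 x v x≢x₀) (sumVecs-zero m)

    sumVecs-snoc : ∀ m (f : Vec (Fin n) (suc m) → Carrier) →
      sumVecs (suc m) f ≈ ∑[ x < n ] sumVecs m (λ v → f (v ∷ʳ x))
    sumVecs-snoc zero    f = refl
    sumVecs-snoc (suc m) f = begin
      ∑[ y < n ] sumVecs (suc m) (λ v → f (y ∷ v))
        ≈⟨ sum-cong-≋ {n} (λ y → sumVecs-snoc m (λ v → f (y ∷ v))) ⟩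
      ∑[ y < n ] ∑[ x < n ] sumVecs m (λ w → f (y ∷ (w ∷ʳ x)))
        ≈⟨ ∑-comm (λ y x → sumVecs m (λ w → f (y ∷ (w ∷ʳ x)))) ⟩
      ∑[ x < n ] sumVecs (suc m) (λ v → f (v ∷ʳ x)) ∎

    sumVecs-reverse : ∀ m (f : Vec (Fin n) m → Carrier) → sumVecs m f ≈ sumVecs m (f ∘ reverse)
    sumVecs-reverse zero    f = refl
    sumVecs-reverse (suc m) f = begin
      sumVecs (suc m) f
        ≈⟨ sumVecs-snoc m f ⟩
      ∑[ x < n ] sumVecs m (λ v → f (v ∷ʳ x))
        ≈⟨ sum-cong-≋ {n} (λ x → sumVecs-reverse m (λ v → f (v ∷ʳ x))) ⟩
      ∑[ x < n ] sumVecs m (λ v → f (reverse v ∷ʳ x))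
        ≈⟨ sum-cong-≋ {n} (λ x → sumVecs-cong m λ v → reflexive (≡.cong f (≡.sym (Vec.reverse-∷ x v)))) ⟩
      sumVecs (suc m) (f ∘ reverse) ∎

    sumVecs-head : ∀ m (G : Fin n → Vec (Fin n) (suc m) → Carrier) →
      (∀ k v → head v ≢ k → G k v ≈ 0#) →
      ∑[ k < n ] sumVecs (suc m) (G k) ≈ sumVecs (suc m) (λ v → G (head v) v)
    sumVecs-head m G G≈0 = begin
      ∑[ k < n ] ∑[ x < n ] sumVecs m (λ v → G k (x ∷ v))
        ≈⟨ ∑-comm (λ k x → sumVecs m (λ v → G k (x ∷ v))) ⟩
      ∑[ x < n ] ∑[ k < n ] sumVecs m (λ v → G k (x ∷ v))
        ≈⟨ sum-cong-≋ {n} (λ x → sym (sumVecs-∑-comm m (λ k v → G k (x ∷ v)))) ⟩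
      ∑[ x < n ] sumVecs m (λ v → ∑[ k < n ] G k (x ∷ v))
        ≈⟨ sum-cong-≋ {n} (λ x → sumVecs-cong m λ v → sum-single _ x λ k k≢x → G≈0 k (x ∷ v) (k≢x ∘ ≡.sym)) ⟩
      ∑[ x < n ] sumVecs m (λ v → G x (x ∷ v)) ∎

  ∑-telescope : ∀ m (A B : ℕ → Carrier) → (∀ L → B (suc (suc L)) + A L ≈ 0#) →
    ∑[ L < suc (suc m) ] (A (toℕ L) + B (toℕ L)) ≈ (B 0 + B 1) + (A m + A (suc m))
  ∑-telescope zero A B _ =
    trans (+-congˡ (+-identityʳ _))
          (solve 4 (λ a₀ b₀ a₁ b₁ → (a₀ ⊕ b₀) ⊕ (a₁ ⊕ b₁) ⊜ (b₀ ⊕ b₁) ⊕ (a₀ ⊕ a₁)) refl (A 0) (B 0) (A 1) (B 1))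
  ∑-telescope (suc m) A B cancel = begin
    (A 0 + B 0) + ∑[ L < suc (suc m) ] (A (suc (toℕ L)) + B (suc (toℕ L)))
      ≈⟨ +-congˡ (∑-telescope m (A ∘ suc) (B ∘ suc) (cancel ∘ suc)) ⟩
    (A 0 + B 0) + ((B 1 + B 2) + Z)
      ≈⟨ solve 5 (λ a₀ b₀ b₁ b₂ z → (a₀ ⊕ b₀) ⊕ ((b₁ ⊕ b₂) ⊕ z) ⊜ ((b₀ ⊕ b₁) ⊕ z) ⊕ (b₂ ⊕ a₀))
               refl (A 0) (B 0) (B 1) (B 2) Z ⟩
    ((B 0 + B 1) + Z) + (B 2 + A 0)
      ≈⟨ +-congˡ (cancel 0) ⟩
    ((B 0 + B 1) + Z) + 0#
      ≈⟨ +-identityʳ _ ⟩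
    (B 0 + B 1) + Z ∎
    where Z = A (suc m) + A (suc (suc m))

module _ {A : Set} where

  data Paired (R : A → A → Set) : List A → Set where
    []  : Paired R []
    _∷_ : ∀ {x y l} → R x y → Paired R l → Paired R (x ∷ y ∷ l)

  Paired-ʳ++ : ∀ {R : A → A → Set} → Symmetric R → ∀ {xs acc} → Paired R xs → Paired R acc → Paired R (xs ʳ++ acc)
  Paired-ʳ++ sym []          acc = acc
  Paired-ʳ++ sym (Rxy ∷ pxs) acc = Paired-ʳ++ sym pxs (sym Rxy ∷ acc)

  Paired-reverse : ∀ {R : A → A → Set} → Symmetric R → ∀ {xs} → Paired R xs → Paired R (List.reverse xs)
  Paired-reverse sym pxs = Paired-ʳ++ sym pxs []

  Linked-ʳ++ : ∀ {R : A → A → Set} → Symmetric R → ∀ {x xs acc} → Linked R (x ∷ xs) → Linked R (x ∷ acc) →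
    Linked R ((x ∷ xs) ʳ++ acc)
  Linked-ʳ++ sym {xs = []}     _            acc = acc
  Linked-ʳ++ sym {xs = y ∷ xs} (Rxy ∷ lxs) acc = Linked-ʳ++ sym lxs (sym Rxy ∷ acc)

  Linked-reverse : ∀ {R : A → A → Set} → Symmetric R → ∀ {xs} → Linked R xs → Linked R (List.reverse xs)
  Linked-reverse sym {[]}     _   = []
  Linked-reverse sym {x ∷ xs} lxs = Linked-ʳ++ sym lxs [-]

  Unique-++⁻ˡ : ∀ xs {ys : List A} → Unique (xs ++ ys) → Unique xs
  Unique-++⁻ˡ []       _             = []
  Unique-++⁻ˡ (x ∷ xs) (x∉ ∷ unique) = All.++⁻ˡ xs x∉ ∷ Unique-++⁻ˡ xs unique

last-∈ : ∀ {A : Set} {L} (v : Vec A (suc L)) → last v ∈ toList v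
last-∈ (x ∷ [])     = here ≡.refl
last-∈ (x ∷ y ∷ ys) = there (last-∈ (y ∷ ys))

Unique⇒length≤ : ∀ {n} (xs : List (Fin n)) → Unique xs → length xs ≤ n
Unique⇒length≤ {zero}  []       _ = z≤n
Unique⇒length≤ {suc n} []       _ = z≤n
Unique⇒length≤ {suc n} (x ∷ xs) (x≢ ∷ unique) =
  s≤s (≡.subst (_≤ n) (length-punchOut xs x≢) (Unique⇒length≤ (punchOutAll xs x≢) (punchOut-unique xs x≢ unique)))
  where
  punchOutAll : ∀ ys → All (x ≢_) ys → List (Fin n)
  punchOutAll []       []           = []
  punchOutAll (y ∷ ys) (x≢y ∷ x≢ys) = punchOut x≢y ∷ punchOutAll ys x≢ys

  length-punchOut : ∀ ys x≢ys → length (punchOutAll ys x≢ys) ≡ length ys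
  length-punchOut []       []           = ≡.refl
  length-punchOut (y ∷ ys) (x≢y ∷ x≢ys) = ≡.cong suc (length-punchOut ys x≢ys)

  punchOut-∉ : ∀ {y} (x≢y : x ≢ y) ys x≢ys → All (y ≢_) ys → All (punchOut x≢y ≢_) (punchOutAll ys x≢ys)
  punchOut-∉ x≢y []       []           []           = []
  punchOut-∉ x≢y (z ∷ zs) (x≢z ∷ x≢zs) (y≢z ∷ y≢zs) =
    (y≢z ∘ punchOut-injective x≢y x≢z) ∷ punchOut-∉ x≢y zs x≢zs y≢zs

  punchOut-unique : ∀ ys x≢ys → Unique ys → Unique (punchOutAll ys x≢ys)
  punchOut-unique []       []           []             = []
  punchOut-unique (y ∷ ys) (x≢y ∷ x≢ys) (y≢ ∷ unique) =
    punchOut-∉ x≢y ys x≢ys y≢ ∷ punchOut-unique ys x≢ys unique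

Fin-≢⇒n≡2+m : ∀ {n} (x y : Fin n) → x ≢ y → ∃ λ m → n ≡ suc (suc m)
Fin-≢⇒n≡2+m {suc zero}    zero zero x≢y = ⊥-elim (x≢y ≡.refl)
Fin-≢⇒n≡2+m {suc (suc m)} _    _    _   = m , ≡.refl

∧-true⁻ : ∀ {a b} → a ∧ b ≡ true → a ≡ true × b ≡ true
∧-true⁻ {true} b≡true = ≡.refl , b≡true

∧-true⁺ : ∀ {a b} → a ≡ true → b ≡ true → a ∧ b ≡ true
∧-true⁺ ≡.refl ≡.refl = ≡.refl

module _ {n : ℕ} where

  ==⇒≡ : ∀ {x y : Fin n} → (x == y) ≡ true → x ≡ y
  ==⇒≡ {x} {y} _ with x Fin.≟ y
  ... | yes x≡y = x≡y

  ≡⇒== : ∀ {x y : Fin n} → x ≡ y → (x == y) ≡ true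
  ≡⇒== {x} {y} x≡y = ≡.trans (isYes≗does (x Fin.≟ y)) (dec-true (x Fin.≟ y) x≡y)

  ≢⇒== : ∀ {x y : Fin n} → x ≢ y → (x == y) ≡ false
  ≢⇒== {x} {y} x≢y = ≡.trans (isYes≗does (x Fin.≟ y)) (dec-false (x Fin.≟ y) x≢y)

  ==-sym : ∀ (x y : Fin n) → (x == y) ≡ (y == x)
  ==-sym x y with y Fin.≟ x
  ... | yes y≡x = ≡⇒== (≡.sym y≡x)
  ... | no  y≢x = ≢⇒== (y≢x ∘ ≡.sym)

  none⇒All≢ : ∀ (x : Fin n) xs → not (any (x ==_) xs) ≡ true → All (x ≢_) xs
  none⇒All≢ x []       _ = []
  none⇒All≢ x (y ∷ ys) none with x Fin.≟ y
  ... | no x≢y = x≢y ∷ none⇒All≢ x ys none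

  All≢⇒none : ∀ {x : Fin n} {xs} → All (x ≢_) xs → not (any (x ==_) xs) ≡ true
  All≢⇒none []                       = ≡.refl
  All≢⇒none {x} (_∷_ {y} x≢y x≢ys) rewrite ≢⇒== x≢y = All≢⇒none x≢ys

  distinct⇒Unique : ∀ xs → distinct xs ≡ true → Unique xs
  distinct⇒Unique []       _ = []
  distinct⇒Unique (x ∷ xs) d =
    let x∉xs , dxs = ∧-true⁻ d in none⇒All≢ x xs x∉xs ∷ distinct⇒Unique xs dxs

  Unique⇒distinct : ∀ {xs} → Unique xs → distinct xs ≡ true
  Unique⇒distinct []              = ≡.refl
  Unique⇒distinct (x∉xs ∷ unique) = ∧-true⁺ (All≢⇒none x∉xs) (Unique⇒distinct unique)

-- Perfect matchings and alternating cycles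

module _ {n : ℕ} (M : Fin n → Fin n) where

  Matched : Fin n → Fin n → Set
  Matched u v = M u ≡ v

  module _ (M-involutive : ∀ u → M (M u) ≡ u) where

    Matched-sym : Symmetric Matched
    Matched-sym {u} Mu≡v = ≡.trans (≡.cong M (≡.sym Mu≡v)) (M-involutive u)

    Paired-Matched-closed : ∀ {l} → Paired Matched l → ∀ {u} → u ∈ l → M u ∈ l
    Paired-Matched-closed (Mu≡v ∷ _) (here ≡.refl)         = there (here Mu≡v)
    Paired-Matched-closed (Mu≡v ∷ _) (there (here ≡.refl)) = here (Matched-sym Mu≡v)
    Paired-Matched-closed (_ ∷ pl)   (there (there u∈l))   = there (there (Paired-Matched-closed pl u∈l))

    Paired⇒altM : ∀ {x l} → Unique (x ∷ l) → Paired Matched (x ∷ l) → altM M true (x ∷ l) ≡ true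
    Paired⇒altM {x} {y ∷ []}    _ (Mx≡y ∷ []) rewrite ≡⇒== Mx≡y = ≡.refl
    Paired⇒altM {x} {y ∷ z ∷ l} ((_ ∷ x≢z ∷ _) ∷ _ ∷ unique) (Mx≡y ∷ pl)
      rewrite ≡⇒== Mx≡y | ≢⇒== (λ My≡z → x≢z (≡.trans (≡.sym (Matched-sym Mx≡y)) My≡z))
      = Paired⇒altM unique pl

  altM-matched : ∀ {x y l} → altM M true (x ∷ y ∷ l) ≡ true → M x ≡ y × altM M false (y ∷ l) ≡ true
  altM-matched {x} {y} alt with M x Fin.≟ y
  ... | yes Mx≡y = Mx≡y , alt

  altM-unmatched : ∀ {y z l} → altM M false (y ∷ z ∷ l) ≡ true → altM M true (z ∷ l) ≡ true
  altM-unmatched {y} {z} alt with M y Fin.≟ z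
  ... | no _ = alt

  altM⇒Paired : ∀ l → altM M true l ≡ true → Paired Matched l
  altM⇒Paired (x ∷ y ∷ [])    alt = proj₁ (altM-matched {l = []} alt) ∷ []
  altM⇒Paired (x ∷ y ∷ z ∷ l) alt =
    let Mx≡y , alt′ = altM-matched {l = z ∷ l} alt in Mx≡y ∷ altM⇒Paired (z ∷ l) (altM-unmatched {l = l} alt′)

module _ {n : ℕ} (X : MixedGraph n) where

  Adjacent : Fin n → Fin n → Set
  Adjacent u v = adj X u v ≡ true

  Adjacent? : ∀ u v → Dec (Adjacent u v)
  Adjacent? u v = adj X u v Bool.≟ true

  adj-sym : ∀ u v → adj X u v ≡ adj X v u
  adj-sym u v = ≡.cong₂ _∨_ (dig-sym X u v) (∨-comm (arc X u v) (arc X v u))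

  Adjacent-sym : Symmetric Adjacent
  Adjacent-sym {u} {v} Auv = ≡.trans (adj-sym v u) Auv

  isWalk⇒Linked : ∀ l → isWalk X l ≡ true → Linked Adjacent l
  isWalk⇒Linked []          _    = []
  isWalk⇒Linked (x ∷ [])    _    = [-]
  isWalk⇒Linked (x ∷ y ∷ l) walk = let Axy , walk′ = ∧-true⁻ walk in Axy ∷ isWalk⇒Linked (y ∷ l) walk′

  Linked⇒isWalk : ∀ {l} → Linked Adjacent l → isWalk X l ≡ true
  Linked⇒isWalk []            = ≡.refl
  Linked⇒isWalk [-]           = ≡.refl
  Linked⇒isWalk (Axy ∷ walk) = ∧-true⁺ Axy (Linked⇒isWalk walk)

  pairPartner : List (Fin n) → (Fin n → Fin n) → Fin n → Fin n
  pairPartner (p ∷ q ∷ W) M u = if u == p then q else if u == q then p else pairPartner W M u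
  pairPartner _           M u = M u

  module _ {p q : Fin n} (W : List (Fin n)) (M : Fin n → Fin n) where

    pairPartner-fst : pairPartner (p ∷ q ∷ W) M p ≡ q
    pairPartner-fst rewrite ≡⇒== (≡.refl {x = p}) = ≡.refl

    pairPartner-snd : p ≢ q → pairPartner (p ∷ q ∷ W) M q ≡ p
    pairPartner-snd p≢q rewrite ≢⇒== (p≢q ∘ ≡.sym) | ≡⇒== (≡.refl {x = q}) = ≡.refl

    pairPartner-rest : ∀ {u} → u ≢ p → u ≢ q → pairPartner (p ∷ q ∷ W) M u ≡ pairPartner W M u
    pairPartner-rest u≢p u≢q rewrite ≢⇒== u≢p | ≢⇒== u≢q = ≡.refl

  pairPartner-outside : ∀ {W} M → Paired Adjacent W → ∀ {u} → u ∉ W → pairPartner W M u ≡ M u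
  pairPartner-outside M []         u∉ = ≡.refl
  pairPartner-outside M (_∷_ {l = W} _ pW) u∉ =
    ≡.trans (pairPartner-rest W M (u∉ ∘ here) (u∉ ∘ there ∘ here)) (pairPartner-outside M pW (u∉ ∘ there ∘ there))

  record PartnerIn (W : List (Fin n)) (f : Fin n → Fin n) (u : Fin n) : Set where
    field
      partner∈      : f u ∈ W
      involutive    : f (f u) ≡ u
      not-fixed     : f u ≢ u
      adjacent      : Adjacent u (f u)

  pairPartner-inside : ∀ {W} M → Paired Adjacent W → Unique W → ∀ {u} → u ∈ W → PartnerIn W (pairPartner W M) u
  pairPartner-inside M (_∷_ {p} {q} {W} Apq _) ((p≢q ∷ _) ∷ _) (here ≡.refl) = record
    { partner∈   = ≡.subst (_∈ p ∷ q ∷ W) (≡.sym fst) (there (here ≡.refl))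
    ; involutive = ≡.trans (≡.cong (pairPartner (p ∷ q ∷ W) M) fst) snd
    ; not-fixed  = λ e → p≢q (≡.trans (≡.sym e) fst)
    ; adjacent   = ≡.subst (Adjacent p) (≡.sym fst) Apq
    }
    where
    fst : pairPartner (p ∷ q ∷ W) M p ≡ q
    fst = pairPartner-fst {p = p} W M
    snd : pairPartner (p ∷ q ∷ W) M q ≡ p
    snd = pairPartner-snd {q = q} W M p≢q
  pairPartner-inside M (_∷_ {p} {q} {W} Apq _) ((p≢q ∷ _) ∷ _) (there (here ≡.refl)) = record
    { partner∈   = ≡.subst (_∈ p ∷ q ∷ W) (≡.sym snd) (here ≡.refl)
    ; involutive = ≡.trans (≡.cong (pairPartner (p ∷ q ∷ W) M) snd) fst
    ; not-fixed  = λ e → p≢q (≡.trans (≡.sym snd) e)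
    ; adjacent   = ≡.subst (Adjacent q) (≡.sym snd) (Adjacent-sym Apq)
    }
    where
    fst : pairPartner (p ∷ q ∷ W) M p ≡ q
    fst = pairPartner-fst {p = p} W M
    snd : pairPartner (p ∷ q ∷ W) M q ≡ p
    snd = pairPartner-snd {q = q} W M p≢q
  pairPartner-inside M (_∷_ {p} {q} {W} _ pW) ((_ ∷ p∉W) ∷ q∉W ∷ uW) {u} (there (there u∈W)) = record
    { partner∈   = ≡.subst (_∈ p ∷ q ∷ W) (≡.sym (step u∈W)) (there (there partner∈))
    ; involutive = ≡.trans (≡.cong (pairPartner (p ∷ q ∷ W) M) (step u∈W)) (≡.trans (step partner∈) involutive)
    ; not-fixed  = λ e → not-fixed (≡.trans (≡.sym (step u∈W)) e)
    ; adjacent   = ≡.subst (Adjacent u) (≡.sym (step u∈W)) adjacent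
    }
    where
    open PartnerIn (pairPartner-inside M pW uW u∈W)
    step : ∀ {v} → v ∈ W → pairPartner (p ∷ q ∷ W) M v ≡ pairPartner W M v
    step v∈W = pairPartner-rest W M (λ v≡p → All.lookup p∉W v∈W (≡.sym v≡p)) (λ v≡q → All.lookup q∉W v∈W (≡.sym v≡q))

  module _ {M : Fin n → Fin n} where

    open Permutation (≡.setoid (Fin n)) using (_↭_; ↭-prep; ↭-trans; ↭-sym; ↭-reflexive)
    open PermutationProperties (≡.setoid (Fin n)) using (↭-shift; Unique-resp-↭; ∈-resp-↭)
    open import Data.List.Membership.DecPropositional (Fin._≟_ {n}) using (_∈?_)

    pairPartner-isPerfectMatching : ∀ {W} → IsPerfectMatching X M → Paired Adjacent W → Unique W →
      (∀ {u} → u ∈ W → M u ∈ W) → IsPerfectMatching X (pairPartner W M)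
    pairPartner-isPerfectMatching {W} (M-involutive , M-not-fixed , M-adjacent) pW uW closed =
      involutive , not-fixed , adjacent
      where
      outside : ∀ {u} → u ∉ W → pairPartner W M u ≡ M u
      outside = pairPartner-outside M pW

      partner-outside : ∀ {u} → u ∉ W → M u ∉ W
      partner-outside {u} u∉W Mu∈W = u∉W (≡.subst (_∈ W) (M-involutive u) (closed Mu∈W))

      involutive : ∀ u → pairPartner W M (pairPartner W M u) ≡ u
      involutive u with u ∈? W
      ... | yes u∈W = PartnerIn.involutive (pairPartner-inside M pW uW u∈W)
      ... | no  u∉W = ≡.trans (≡.cong (pairPartner W M) (outside u∉W))
                              (≡.trans (outside (partner-outside u∉W)) (M-involutive u))

      not-fixed : ∀ u → pairPartner W M u ≢ u
      not-fixed u with u ∈? W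
      ... | yes u∈W = PartnerIn.not-fixed (pairPartner-inside M pW uW u∈W)
      ... | no  u∉W = M-not-fixed u ∘ ≡.trans (≡.sym (outside u∉W))

      adjacent : ∀ u → Adjacent u (pairPartner W M u)
      adjacent u with u ∈? W
      ... | yes u∈W = PartnerIn.adjacent (pairPartner-inside M pW uW u∈W)
      ... | no  u∉W = ≡.subst (Adjacent u) (≡.sym (outside u∉W)) (M-adjacent u)

    module _ (col : Fin n → Bool) (proper : ∀ u v → Adjacent u v → col u ≢ col v) where

      evenSegment : ∀ {a l i} → Paired (Matched M) (a ∷ l) → Linked Adjacent (a ∷ l) → i ∈ a ∷ l →
        col i ≢ col a →
        ∃₂ λ mid rest → l ≡ mid ++ i ∷ rest × Paired Adjacent mid × Paired (Matched M) (a ∷ mid ++ i ∷ [])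
      evenSegment _ _ (here ≡.refl) ci≢ca = ⊥-elim (ci≢ca ≡.refl)
      evenSegment {l = b ∷ rest} (Ma≡b ∷ _) _ (there (here ≡.refl)) _ =
        [] , rest , ≡.refl , [] , Ma≡b ∷ []
      evenSegment {a} {b ∷ c ∷ l} {i} (Ma≡b ∷ pl) (Aab ∷ Abc ∷ walk) (there (there i∈)) ci≢ca =
        let mid , rest , l≡ , pmid , pseg = evenSegment pl walk i∈ ci≢cc
        in b ∷ c ∷ mid , rest , ≡.cong (λ t → b ∷ c ∷ t) l≡ , Abc ∷ pmid , Ma≡b ∷ pseg
        where
        ci≢cc : col i ≢ col c
        ci≢cc ci≡cc = ci≢ca (≡.trans ci≡cc (≡.trans (¬-not (proper c b (Adjacent-sym Abc)))
                                                     (≡.sym (¬-not (proper a b Aab)))))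

      neighbour-on-alternating-path : IsUniquePerfectMatching X M → ∀ {a l i} →
        Paired (Matched M) (a ∷ l) → Linked Adjacent (a ∷ l) → Unique (a ∷ l) →
        Adjacent i a → i ∈ a ∷ l → M a ≡ i
      neighbour-on-alternating-path (pm , M-unique) {a} {l} {i} pl walk ul Aia i∈ =
        let mid , rest , l≡ , pmid , pseg = evenSegment pl walk i∈ (proper i a Aia) in
        closes mid rest l≡ pmid pseg
        where
        closes : ∀ mid rest → l ≡ mid ++ i ∷ rest → Paired Adjacent mid →
                 Paired (Matched M) (a ∷ mid ++ i ∷ []) → M a ≡ i
        -- Re-matching a with i and the inner vertices of the segment in consecutive pairs is again a
        -- perfect matching, so by uniqueness it agrees with M at a.
        closes mid rest ≡.refl pmid pseg =
          ≡.trans (≡.sym (M-unique (pairPartner W M) pmW a)) (pairPartner-fst {p = a} mid M)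
          where
          W = a ∷ i ∷ mid

          seg↭W : a ∷ mid ++ i ∷ [] ↭ W
          seg↭W = ↭-prep a (↭-trans (↭-shift mid []) (↭-prep i (↭-reflexive (List.++-identityʳ mid))))

          closed : ∀ {u} → u ∈ W → M u ∈ W
          closed u∈W = ∈-resp-↭ seg↭W (Paired-Matched-closed M (proj₁ pm) pseg (∈-resp-↭ (↭-sym seg↭W) u∈W))

          pmW : IsPerfectMatching X (pairPartner W M)
          pmW = pairPartner-isPerfectMatching pm (Adjacent-sym Aia ∷ pmid)
                  (Unique-++⁻ˡ W (Unique-resp-↭ (↭-prep a (↭-shift mid rest)) ul)) closed

transpose : ∀ {n} → MixedGraph n → MixedGraph n
transpose X = record
  { dig      = dig X
  ; arc      = λ u v → arc X v u
  ; dig-sym  = dig-sym X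
  ; dig-irr  = dig-irr X
  ; arc-irr  = arc-irr X
  ; arc-asym = λ u v → arc-asym X v u
  ; dig-arc  = λ u v duv → dig-arc X v u (≡.trans (dig-sym X v u) duv)
  }

adj-transpose : ∀ {n} (X : MixedGraph n) u v → adj (transpose X) u v ≡ adj X u v
adj-transpose X u v = ≡.cong (dig X u v ∨_) (∨-comm (arc X v u) (arc X u v))

module _ {n : ℕ} {X Y : MixedGraph n} (same-adj : ∀ u v → adj Y u v ≡ adj X u v) where

  IsBipartite-resp : IsBipartite X → IsBipartite Y
  IsBipartite-resp (col , proper) = col , λ u v Auv → proper u v (≡.trans (≡.sym (same-adj u v)) Auv)

  IsPerfectMatching-resp : ∀ {M} → IsPerfectMatching X M → IsPerfectMatching Y M
  IsPerfectMatching-resp {M} (involutive , not-fixed , adjacent) =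
    involutive , not-fixed , λ u → ≡.trans (same-adj u (M u)) (adjacent u)

IsUniquePerfectMatching-resp : ∀ {n} {X Y : MixedGraph n} → (∀ u v → adj Y u v ≡ adj X u v) →
  ∀ {M} → IsUniquePerfectMatching X M → IsUniquePerfectMatching Y M
IsUniquePerfectMatching-resp {X = X} {Y} same-adj (pm , unique) =
  IsPerfectMatching-resp {X = X} {Y} same-adj pm ,
  λ m pm′ → unique m (IsPerfectMatching-resp {X = Y} {X} (λ u v → ≡.sym (same-adj u v)) pm′)

module _ {c ℓ} (R : CommutativeRing c ℓ) {n : ℕ} (X : MixedGraph n) (α ᾱ : CommutativeRing.Carrier R) where

  open CommutativeRing R hiding (zero)

  Hα-transpose : ∀ u v → Hα R (transpose X) α ᾱ u v ≡ Hα R X α ᾱ v u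
  Hα-transpose u v rewrite dig-sym X u v = ≡.refl

  Hα-nonadjacent : ∀ {u v} → adj X u v ≡ false → Hα R X α ᾱ u v ≡ 0#
  Hα-nonadjacent {u} {v} nonadjacent with dig X u v | arc X u v | arc X v u
  ... | false | false | false = ≡.refl

  Hα-inverse : α * ᾱ ≈ 1# → ∀ {u v} → Adjacent X u v → Hα R X α ᾱ u v * Hα R X α ᾱ v u ≈ 1#
  Hα-inverse αᾱ≈1 {u} {v} Auv rewrite dig-sym X v u with dig X u v | arc X u v in auv | arc X v u in avu
  ... | true  | _     | _     = *-identityˡ 1#
  ... | false | true  | false = αᾱ≈1
  ... | false | false | true  = trans (*-comm ᾱ α) αᾱ≈1
  ... | false | true  | true  with () ← ≡.trans (≡.sym avu) (arc-asym X u v auv)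

-- Co-augmenting paths

module _ {n : ℕ} (X : MixedGraph n) (M : Fin n → Fin n) where

  -- Only the matching edges are recorded: on a path the remaining edges cannot be matching edges,
  -- since M is an involution and the vertices are distinct.
  record CoAugPath (k j : Fin n) {L} (Q : Vec (Fin n) (suc L)) : Set where
    field
      head≡   : head Q ≡ k
      last≡   : last Q ≡ j
      unique  : Unique (toList Q)
      walk    : Linked (Adjacent X) (toList Q)
      matched : Paired (Matched M) (toList Q)

  isCoAugPath⇒CoAugPath : ∀ {k j L} (Q : Vec (Fin n) (suc L)) → isCoAugPath X M k j Q ≡ true → CoAugPath k j Q
  isCoAugPath⇒CoAugPath Q coAug =
    let head≡  , coAug₁  = ∧-true⁻ coAug
        last≡  , coAug₂  = ∧-true⁻ coAug₁
        unique , coAug₃  = ∧-true⁻ coAug₂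
        walk   , matched = ∧-true⁻ coAug₃
    in record
      { head≡   = ==⇒≡ head≡
      ; last≡   = ==⇒≡ last≡
      ; unique  = distinct⇒Unique (toList Q) unique
      ; walk    = isWalk⇒Linked X (toList Q) walk
      ; matched = altM⇒Paired M (toList Q) matched
      }

  CoAugPath⇒isCoAugPath : (∀ u → M (M u) ≡ u) → ∀ {k j L} {Q : Vec (Fin n) (suc L)} →
    CoAugPath k j Q → isCoAugPath X M k j Q ≡ true
  CoAugPath⇒isCoAugPath M-involutive {Q = x ∷ v} path =
    ∧-true⁺ (≡⇒== head≡) (∧-true⁺ (≡⇒== last≡) (∧-true⁺ (Unique⇒distinct unique)
      (∧-true⁺ (Linked⇒isWalk X walk) (Paired⇒altM M M-involutive unique matched))))
    where open CoAugPath path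

  coAugPath? : (∀ u → M (M u) ≡ u) → ∀ k j {L} (Q : Vec (Fin n) (suc L)) → Dec (CoAugPath k j Q)
  coAugPath? M-involutive k j Q =
    map′ (isCoAugPath⇒CoAugPath Q) (CoAugPath⇒isCoAugPath M-involutive) (isCoAugPath X M k j Q Bool.≟ true)

  CoAugPath-loop : ∀ {k L} {Q : Vec (Fin n) (suc L)} → ¬ CoAugPath k k Q
  CoAugPath-loop {Q = x ∷ y ∷ v} path =
    All.lookup (AllPairs.head unique) (last-∈ (y ∷ v)) (≡.trans head≡ (≡.sym last≡))
    where open CoAugPath path

  module _ (pm : IsPerfectMatching X M) where

    private
      M-involutive = proj₁ pm

    CoAugPath-second : ∀ {i y j L} {u : Vec (Fin n) L} → CoAugPath (M i) j (M i ∷ y ∷ u) → y ≡ i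
    CoAugPath-second path = ≡.trans (≡.sym (Paired-head (CoAugPath.matched path))) (M-involutive _)
      where
      Paired-head : ∀ {x y l} → Paired (Matched M) (x ∷ y ∷ l) → M x ≡ y
      Paired-head (Mx≡y ∷ _) = Mx≡y

    CoAugPath-extend : ∀ {i j L} {u : Vec (Fin n) (suc L)} → i ∉ toList u → Adjacent X i (head u) →
      CoAugPath (head u) j u → CoAugPath (M i) j (M i ∷ i ∷ u)
    CoAugPath-extend {i} {u = x ∷ v} i∉u Aix path = record
      { head≡   = ≡.refl
      ; last≡   = last≡
      ; unique  = All.¬Any⇒All¬ _ Mi∉ ∷ All.¬Any⇒All¬ _ i∉u ∷ unique
      ; walk    = Adjacent-sym X (proj₂ (proj₂ pm) i) ∷ Aix ∷ walk
      ; matched = M-involutive i ∷ matched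
      }
      where
      open CoAugPath path
      Mi∉ : M i ∉ i ∷ toList (x ∷ v)
      Mi∉ (here Mi≡i)   = proj₁ (proj₂ pm) i Mi≡i
      Mi∉ (there Mi∈u) = i∉u (≡.subst (_∈ _) (M-involutive i) (Paired-Matched-closed M M-involutive matched Mi∈u))

    CoAugPath-shrink : ∀ {i j L} {u : Vec (Fin n) (suc L)} → CoAugPath (M i) j (M i ∷ i ∷ u) →
      Adjacent X i (head u) × CoAugPath (head u) j u
    CoAugPath-shrink {u = x ∷ v} path = Linked.head (Linked.tail walk) , record
      { head≡   = ≡.refl
      ; last≡   = last≡
      ; unique  = AllPairs.tail (AllPairs.tail unique)
      ; walk    = Linked.tail (Linked.tail walk)
      ; matched = Paired-tail matched
      }
      where
      open CoAugPath path
      Paired-tail : ∀ {x y l} → Paired (Matched M) (x ∷ y ∷ l) → Paired (Matched M) l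
      Paired-tail (_ ∷ pl) = pl

    CoAugPath-length : ∀ {i k j L} {Q : Vec (Fin n) (suc L)} → i ∉ toList Q → CoAugPath k j Q → suc (suc (suc L)) ≤ n
    CoAugPath-length {i} {Q = Q} i∉Q path =
      ≡.subst (λ m → suc (suc m) ≤ n) (Vec.length-toList Q) (Unique⇒length≤ (i ∷ M i ∷ toList Q)
        (All.¬Any⇒All¬ _ i∉ ∷ All.¬Any⇒All¬ _ Mi∉Q ∷ unique))
      where
      open CoAugPath path
      Mi∉Q : M i ∉ toList Q
      Mi∉Q Mi∈Q = i∉Q (≡.subst (_∈ _) (M-involutive i) (Paired-Matched-closed M M-involutive matched Mi∈Q))
      i∉ : i ∉ M i ∷ toList Q
      i∉ (here i≡Mi) = proj₁ (proj₂ pm) i (≡.sym i≡Mi)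
      i∉ (there i∈Q) = i∉Q i∈Q

module _ {n : ℕ} {X Y : MixedGraph n} {M : Fin n → Fin n} (M-involutive : ∀ u → M (M u) ≡ u)
         (same-adj : ∀ u v → adj Y u v ≡ adj X u v) where

  open PermutationProperties (≡.setoid (Fin n)) using (Unique-resp-↭; ↭-reverse)
  open Permutation (≡.setoid (Fin n)) using (↭-sym)

  CoAugPath-reverse : ∀ {k j L} {Q : Vec (Fin n) (suc L)} → CoAugPath X M k j Q → CoAugPath Y M j k (reverse Q)
  CoAugPath-reverse {Q = Q} path = record
    { head≡   = ≡.trans (≡.sym (Vec.last-reverse (reverse Q)))
                        (≡.trans (≡.cong last (Vec.reverse-involutive Q)) last≡)
    ; last≡   = ≡.trans (Vec.last-reverse Q) head≡
    ; unique  = toList-reverse {Unique} (Unique-resp-↭ (↭-sym (↭-reverse (toList Q))) unique)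
    ; walk    = toList-reverse {Linked (Adjacent Y)} (Linked-reverse (Adjacent-sym Y)
                  (Linked.map (λ {u} {v} Auv → ≡.trans (same-adj u v) Auv) walk))
    ; matched = toList-reverse {Paired (Matched M)} (Paired-reverse (Matched-sym M M-involutive) matched)
    }
    where
    open CoAugPath path
    toList-reverse : ∀ {P : List (Fin n) → Set} → P (List.reverse (toList Q)) → P (toList (reverse Q))
    toList-reverse {P} = ≡.subst P (≡.sym (Vec.toList-reverse Q))

isCoAugPath-transpose : ∀ {n} {X : MixedGraph n} {M : Fin n → Fin n} → (∀ u → M (M u) ≡ u) →
  ∀ {k j L} (Q : Vec (Fin n) (suc L)) → isCoAugPath (transpose X) M k j (reverse Q) ≡ isCoAugPath X M j k Q
isCoAugPath-transpose {X = X} {M} M-involutive {k} {j} Q = ⇔→≡ {z = true} (mk⇔ to from)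
  where
  to : isCoAugPath (transpose X) M k j (reverse Q) ≡ true → isCoAugPath X M j k Q ≡ true
  to coAug = CoAugPath⇒isCoAugPath X M M-involutive
    (≡.subst (CoAugPath X M j k) (Vec.reverse-involutive Q)
      (CoAugPath-reverse M-involutive (λ u v → ≡.sym (adj-transpose X u v))
        (isCoAugPath⇒CoAugPath (transpose X) M (reverse Q) coAug)))
  from : isCoAugPath X M j k Q ≡ true → isCoAugPath (transpose X) M k j (reverse Q) ≡ true
  from coAug = CoAugPath⇒isCoAugPath (transpose X) M M-involutive
    (CoAugPath-reverse M-involutive (adj-transpose X) (isCoAugPath⇒CoAugPath X M Q coAug))

module _ {c ℓ} (R : CommutativeRing c ℓ) where

  open CommutativeRing R hiding (zero)
  open FiniteSums R
  open import Relation.Binary.Reasoning.Setoid setoid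

  hPath-ʳ++ : ∀ {n} (h h′ : Fin n → Fin n → Carrier) → (∀ u v → h′ u v ≈ h v u) →
    ∀ x xs acc → hPath R h′ ((x ∷ xs) List.ʳ++ acc) ≈ hPath R h (x ∷ xs) * hPath R h′ (x ∷ acc)
  hPath-ʳ++ h h′ h′≈ x []       acc = sym (*-identityˡ _)
  hPath-ʳ++ h h′ h′≈ x (y ∷ xs) acc = begin
    hPath R h′ ((y ∷ xs) List.ʳ++ (x ∷ acc))                  ≈⟨ hPath-ʳ++ h h′ h′≈ y xs (x ∷ acc) ⟩
    hPath R h (y ∷ xs) * (h′ y x * hPath R h′ (x ∷ acc))      ≈⟨ *-congˡ (*-congʳ (h′≈ y x)) ⟩
    hPath R h (y ∷ xs) * (h x y * hPath R h′ (x ∷ acc))       ≈⟨ x∙yz≈y∙xz _ _ _ ⟩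
    h x y * (hPath R h (y ∷ xs) * hPath R h′ (x ∷ acc))       ≈⟨ *-assoc _ _ _ ⟨
    h x y * hPath R h (y ∷ xs) * hPath R h′ (x ∷ acc)         ∎
    where open import Algebra.Properties.CommutativeSemigroup *-commutativeSemigroup using (x∙yz≈y∙xz)

  hPath-reverse : ∀ {n} (h h′ : Fin n → Fin n → Carrier) → (∀ u v → h′ u v ≈ h v u) →
    ∀ l → hPath R h′ (List.reverse l) ≈ hPath R h l
  hPath-reverse h h′ h′≈ []       = refl
  hPath-reverse h h′ h′≈ (x ∷ xs) = trans (hPath-ʳ++ h h′ h′≈ x xs []) (*-identityʳ _)

  module _ {n : ℕ} (X : MixedGraph n) (M : Fin n → Fin n) (α ᾱ : Carrier) where

    pathTerm : Fin n → Fin n → (L : ℕ) → Vec (Fin n) (suc L) → Carrier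
    pathTerm k j L Q =
      if isCoAugPath X M k j Q then neg1^ R ⌊ L ∸ 1 /2⌋ * hPath R (Hα R X α ᾱ) (toList Q) else 0#

    coAugSum-expand : ∀ k j → coAugSum R X M α ᾱ k j ≈ ∑[ L < n ] sumVecs (suc (toℕ L)) (pathTerm k j (toℕ L))
    coAugSum-expand k j = trans (reflexive (sumFin≡sum n _))
      (sum-cong-≋ {n} λ L → sumList-allVecs (suc (toℕ L)) (pathTerm k j (toℕ L)))

    pathTerm-vanishes : ∀ {k j L} (Q : Vec (Fin n) (suc L)) → ¬ CoAugPath X M k j Q → pathTerm k j L Q ≡ 0#
    pathTerm-vanishes {k} {j} Q ¬path with isCoAugPath X M k j Q in coAug
    ... | true  = ⊥-elim (¬path (isCoAugPath⇒CoAugPath X M Q coAug))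
    ... | false = ≡.refl

    pathTerm-path : (∀ u → M (M u) ≡ u) → ∀ {k j L} {Q : Vec (Fin n) (suc L)} → CoAugPath X M k j Q →
      pathTerm k j L Q ≡ neg1^ R ⌊ L ∸ 1 /2⌋ * hPath R (Hα R X α ᾱ) (toList Q)
    pathTerm-path M-involutive path rewrite CoAugPath⇒isCoAugPath X M M-involutive path = ≡.refl

    coAugSum-loop : ∀ k → coAugSum R X M α ᾱ k k ≈ 0#
    coAugSum-loop k = begin
      coAugSum R X M α ᾱ k k
        ≈⟨ coAugSum-expand k k ⟩
      ∑[ L < n ] sumVecs (suc (toℕ L)) (pathTerm k k (toℕ L))
        ≈⟨ sum-cong-≋ {n} (λ L → trans (sumVecs-cong {n} (suc (toℕ L)) λ Q →
                                          reflexive (pathTerm-vanishes Q (CoAugPath-loop X M {k})))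
                                        (sumVecs-zero {n} (suc (toℕ L)))) ⟩
      ∑[ L < n ] 0#
        ≈⟨ sum-zero n ⟩
      0# ∎

    Bmat≈coAugSum : ∀ k j → Bmat R X M α ᾱ k j ≈ coAugSum R X M α ᾱ k j
    Bmat≈coAugSum k j with k Fin.≟ j
    ... | yes ≡.refl = sym (coAugSum-loop k)
    ... | no  _      = refl

  coAugSum-transpose : ∀ {n} (X : MixedGraph n) (M : Fin n → Fin n) (α ᾱ : Carrier) → (∀ u → M (M u) ≡ u) →
    ∀ k j → coAugSum R (transpose X) M α ᾱ k j ≈ coAugSum R X M α ᾱ j k
  coAugSum-transpose {n} X M α ᾱ M-involutive k j = begin
    coAugSum R (transpose X) M α ᾱ k j
      ≈⟨ coAugSum-expand (transpose X) M α ᾱ k j ⟩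
    ∑[ L < n ] sumVecs (suc (toℕ L)) (pathTerm (transpose X) M α ᾱ k j (toℕ L))
      ≈⟨ sum-cong-≋ {n} (λ L → sumVecs-reverse (suc (toℕ L)) (pathTerm (transpose X) M α ᾱ k j (toℕ L))) ⟩
    ∑[ L < n ] sumVecs (suc (toℕ L)) (pathTerm (transpose X) M α ᾱ k j (toℕ L) ∘ reverse)
      ≈⟨ sum-cong-≋ {n} (λ L → sumVecs-cong {n} (suc (toℕ L)) (pathTerm-reverse (toℕ L))) ⟩
    ∑[ L < n ] sumVecs (suc (toℕ L)) (pathTerm X M α ᾱ j k (toℕ L))
      ≈⟨ coAugSum-expand X M α ᾱ j k ⟨
    coAugSum R X M α ᾱ j k ∎
    where
    hPath-reverse′ : ∀ {L} (Q : Vec (Fin n) (suc L)) →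
      hPath R (Hα R (transpose X) α ᾱ) (toList (reverse Q)) ≈ hPath R (Hα R X α ᾱ) (toList Q)
    hPath-reverse′ Q = trans (reflexive (≡.cong (hPath R (Hα R (transpose X) α ᾱ)) (Vec.toList-reverse Q)))
      (hPath-reverse (Hα R X α ᾱ) (Hα R (transpose X) α ᾱ) (λ u v → reflexive (Hα-transpose R X α ᾱ u v)) (toList Q))

    pathTerm-reverse : ∀ L (Q : Vec (Fin n) (suc L)) →
      pathTerm (transpose X) M α ᾱ k j L (reverse Q) ≈ pathTerm X M α ᾱ j k L Q
    pathTerm-reverse L Q
      with isCoAugPath (transpose X) M k j (reverse Q) | isCoAugPath X M j k Q
         | isCoAugPath-transpose {X = X} {M} M-involutive {k} {j} Q
    ... | true  | true  | _  = *-congˡ (hPath-reverse′ Q)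
    ... | false | false | _  = refl
    ... | true  | false | ()
    ... | false | true  | ()

  -- The identity Hα B = I

  module RowIdentity (α ᾱ : Carrier) (αᾱ≈1 : α * ᾱ ≈ 1#) {n} (X : MixedGraph n) (bipartite : IsBipartite X)
             (M : Fin n → Fin n) (ump : IsUniquePerfectMatching X M) (i j : Fin n) where

    open import Data.List.Membership.DecPropositional (Fin._≟_ {n}) using (_∈?_)
    open import Algebra.Properties.Ring ring using (-‿distribˡ-*; -‿distribʳ-*)
    open import Algebra.Solver.CommutativeMonoid *-commutativeMonoid
      renaming (solve to solve*; _⊕_ to _⊗_; _⊜_ to _⊜*_)

    pm : IsPerfectMatching X M
    pm = proj₁ ump

    M-involutive : ∀ u → M (M u) ≡ u
    M-involutive = proj₁ pm

    h : Fin n → Fin n → Carrier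
    h = Hα R X α ᾱ

    term : Fin n → Fin n → (L : ℕ) → Vec (Fin n) (suc L) → Carrier
    term = pathTerm X M α ᾱ

    δ : Carrier
    δ = if i == j then 1# else 0#

    rowTerm through avoiding : (L : ℕ) → Vec (Fin n) (suc L) → Carrier
    rowTerm  L Q = h i (head Q) * term (head Q) j L Q
    through  L Q = if isYes (i ∈? toList Q) then rowTerm L Q else 0#
    avoiding L Q = if isYes (i ∈? toList Q) then 0# else rowTerm L Q

    Through Avoiding : ℕ → Carrier
    Through  L = sumVecs (suc L) (through L)
    Avoiding L = sumVecs (suc L) (avoiding L)

    rowTerm-vanishes : ∀ {L} (Q : Vec (Fin n) (suc L)) →
      (Adjacent X i (head Q) → ¬ CoAugPath X M (head Q) j Q) → rowTerm L Q ≈ 0#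
    rowTerm-vanishes Q ¬path with adj X i (head Q) in Ai
    ... | false = trans (*-congʳ (reflexive (Hα-nonadjacent R X α ᾱ Ai))) (zeroˡ _)
    ... | true  = trans (*-congˡ (reflexive (pathTerm-vanishes X M α ᾱ Q (¬path ≡.refl)))) (zeroʳ _)

    through-vanishes : ∀ {L} (Q : Vec (Fin n) (suc L)) →
      (i ∈ toList Q → Adjacent X i (head Q) → ¬ CoAugPath X M (head Q) j Q) → through L Q ≈ 0#
    through-vanishes Q ¬path with i ∈? toList Q
    ... | yes i∈Q = rowTerm-vanishes Q (¬path i∈Q)
    ... | no  _   = refl

    avoiding-vanishes : ∀ {L} (Q : Vec (Fin n) (suc L)) →
      (i ∉ toList Q → Adjacent X i (head Q) → ¬ CoAugPath X M (head Q) j Q) → avoiding L Q ≈ 0#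
    avoiding-vanishes Q ¬path with i ∈? toList Q
    ... | yes _   = refl
    ... | no  i∉Q = rowTerm-vanishes Q (¬path i∉Q)

    through-∈ : ∀ {L} (Q : Vec (Fin n) (suc L)) → i ∈ toList Q → through L Q ≡ rowTerm L Q
    through-∈ Q i∈Q with i ∈? toList Q
    ... | yes _   = ≡.refl
    ... | no  i∉Q = ⊥-elim (i∉Q i∈Q)

    avoiding-∉ : ∀ {L} (Q : Vec (Fin n) (suc L)) → i ∉ toList Q → avoiding L Q ≡ rowTerm L Q
    avoiding-∉ Q i∉Q with i ∈? toList Q
    ... | yes i∈Q = ⊥-elim (i∉Q i∈Q)
    ... | no  _   = ≡.refl

    rowTerm-split : ∀ {L} (Q : Vec (Fin n) (suc L)) → rowTerm L Q ≈ avoiding L Q + through L Q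
    rowTerm-split Q with i ∈? toList Q
    ... | yes _ = sym (+-identityˡ _)
    ... | no  _ = sym (+-identityʳ _)

    Through-0 : Through 0 ≈ 0#
    Through-0 = trans (sumVecs-cong 1 {through 0} {λ _ → 0#} λ { (x ∷ []) →
                        through-vanishes (x ∷ []) λ _ _ path → single-vertex (CoAugPath.matched path) })
                      (sumVecs-zero {n} 1)
      where
      single-vertex : ∀ {x} → ¬ Paired (Matched M) (x ∷ [])
      single-vertex ()

    Through-reduce : ∀ L → Through (suc L) ≈ sumVecs L (λ u → through (suc L) (M i ∷ i ∷ u))
    Through-reduce L = trans (sumVecs-single (suc L) (through (suc L)) (M i) off-partner)
                             (sumVecs-single L (λ v → through (suc L) (M i ∷ v)) i off-i)
      where
      off-partner : ∀ x v → x ≢ M i → through (suc L) (x ∷ v) ≈ 0#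
      off-partner x v x≢Mi = through-vanishes (x ∷ v) λ i∈ Aix path → x≢Mi
        (≡.trans (≡.sym (M-involutive x)) (≡.cong M
          (neighbour-on-alternating-path X (proj₁ bipartite) (proj₂ bipartite) ump
            (CoAugPath.matched path) (CoAugPath.walk path) (CoAugPath.unique path) Aix i∈)))

      off-i : ∀ y u → y ≢ i → through (suc L) (M i ∷ y ∷ u) ≈ 0#
      off-i y u y≢i = through-vanishes (M i ∷ y ∷ u) λ _ _ path → y≢i (CoAugPath-second X M pm path)

    Through-1 : Through 1 ≈ δ
    Through-1 = trans (Through-reduce 0)
                      (trans (reflexive (through-∈ (M i ∷ i ∷ []) (there (here ≡.refl)))) (edge (i Fin.≟ j)))
      where
      δ≡ : ∀ {b} → (i == j) ≡ b → δ ≡ (if b then 1# else 0#)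
      δ≡ = ≡.cong (λ b → if b then 1# else 0#)

      edge : Dec (i ≡ j) → rowTerm 1 (M i ∷ i ∷ []) ≈ δ
      edge (no i≢j) = trans (rowTerm-vanishes (M i ∷ i ∷ []) λ _ path → i≢j (CoAugPath.last≡ path))
                            (reflexive (≡.sym (δ≡ (≢⇒== i≢j))))
      edge (yes ≡.refl) = begin
        h i (M i) * term (M i) i 1 (M i ∷ i ∷ [])
          ≈⟨ *-congˡ (reflexive (pathTerm-path X M α ᾱ M-involutive matchedEdge)) ⟩
        h i (M i) * (1# * (h (M i) i * 1#))
          ≈⟨ *-congˡ (trans (*-identityˡ _) (*-identityʳ _)) ⟩
        h i (M i) * h (M i) i
          ≈⟨ Hα-inverse R X α ᾱ αᾱ≈1 (proj₂ (proj₂ pm) i) ⟩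
        1#
          ≡⟨ δ≡ (≡⇒== ≡.refl) ⟨
        δ ∎
        where
        matchedEdge : CoAugPath X M (M i) i (M i ∷ i ∷ [])
        matchedEdge = record
          { head≡   = ≡.refl
          ; last≡   = ≡.refl
          ; unique  = (proj₁ (proj₂ pm) i ∷ []) ∷ [] ∷ []
          ; walk    = Adjacent-sym X (proj₂ (proj₂ pm) i) ∷ [-]
          ; matched = M-involutive i ∷ []
          }

    rowTerm-extend : ∀ L (u : Vec (Fin n) (suc L)) → i ∉ toList u →
      rowTerm (suc (suc L)) (M i ∷ i ∷ u) + rowTerm L u ≈ 0#
    rowTerm-extend L u i∉u with Adjacent? X i (head u) ×-dec coAugPath? X M M-involutive (head u) j u
    ... | no ¬ext           = trans (+-cong (rowTerm-vanishes (M i ∷ i ∷ u) λ _ → ¬ext ∘ CoAugPath-shrink X M pm)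
                                            (rowTerm-vanishes u λ Aiu path → ¬ext (Aiu , path)))
                                    (+-identityˡ 0#)
    ... | yes (Aiu , path) = cancel u i∉u Aiu path
      where
      cancel : ∀ {L} (u : Vec (Fin n) (suc L)) → i ∉ toList u → Adjacent X i (head u) →
        CoAugPath X M (head u) j u → rowTerm (suc (suc L)) (M i ∷ i ∷ u) + rowTerm L u ≈ 0#
      cancel (x ∷ []) _ _ path with () ← CoAugPath.matched path
      -- ⌊ (L + 2) /2⌋ reduces to suc ⌊ L /2⌋, so the extended path has the opposite sign.
      cancel {suc L} u@(x ∷ _ ∷ _) i∉u Aix path = begin
        rowTerm (suc (suc (suc L))) (M i ∷ i ∷ u) + rowTerm (suc L) u
          ≈⟨ +-cong (*-congˡ (reflexive (pathTerm-path X M α ᾱ M-involutive extended)))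
                    (*-congˡ (reflexive (pathTerm-path X M α ᾱ M-involutive path))) ⟩
        a * (- s * (b * (d * p))) + d * (s * p)
          ≈⟨ +-congʳ (*-congˡ (-‿distribˡ-* s _)) ⟨
        a * - (s * (b * (d * p))) + d * (s * p)
          ≈⟨ +-congʳ (-‿distribʳ-* a _) ⟨
        - (a * (s * (b * (d * p)))) + d * (s * p)
          ≈⟨ +-congʳ (-‿cong (solve* 5 (λ a s b d p → a ⊗ (s ⊗ (b ⊗ (d ⊗ p))) ⊜* (a ⊗ b) ⊗ (d ⊗ (s ⊗ p)))
                                     refl a s b d p)) ⟩
        - (a * b * (d * (s * p))) + d * (s * p)
          ≈⟨ +-congʳ (-‿cong (trans (*-congʳ ab≈1) (*-identityˡ _))) ⟩
        - (d * (s * p)) + d * (s * p)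
          ≈⟨ -‿inverseˡ _ ⟩
        0# ∎
        where
        a = h i (M i)
        b = h (M i) i
        d = h i x
        s = neg1^ R ⌊ L /2⌋
        p = hPath R h (toList u)

        ab≈1 : a * b ≈ 1#
        ab≈1 = Hα-inverse R X α ᾱ αᾱ≈1 (proj₂ (proj₂ pm) i)

        extended : CoAugPath X M (M i) j (M i ∷ i ∷ u)
        extended = CoAugPath-extend X M pm i∉u Aix path

    Through-Avoiding : ∀ L → Through (suc (suc L)) + Avoiding L ≈ 0#
    Through-Avoiding L = begin
      Through (suc (suc L)) + Avoiding L
        ≈⟨ +-congʳ (Through-reduce (suc L)) ⟩
      sumVecs (suc L) (λ u → through (suc (suc L)) (M i ∷ i ∷ u)) + Avoiding L
        ≈⟨ sumVecs-distrib-+ (suc L) (λ u → through (suc (suc L)) (M i ∷ i ∷ u)) (avoiding L) ⟨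
      sumVecs (suc L) (λ u → through (suc (suc L)) (M i ∷ i ∷ u) + avoiding L u)
        ≈⟨ sumVecs-cong {n} (suc L) step ⟩
      sumVecs {n} (suc L) (λ _ → 0#)
        ≈⟨ sumVecs-zero {n} (suc L) ⟩
      0# ∎
      where
      step′ : ∀ u → Dec (i ∈ toList u) → through (suc (suc L)) (M i ∷ i ∷ u) + avoiding L u ≈ 0#
      step′ u (yes i∈u) = trans (+-cong (through-vanishes (M i ∷ i ∷ u) λ _ _ path →
                                           All.lookup (AllPairs.head (AllPairs.tail (CoAugPath.unique path)))
                                                      i∈u ≡.refl)
                                         (avoiding-vanishes u λ i∉u → ⊥-elim (i∉u i∈u)))
                                 (+-identityˡ 0#)
      step′ u (no i∉u)  = trans (+-cong (reflexive (through-∈ (M i ∷ i ∷ u) (there (here ≡.refl))))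
                                         (reflexive (avoiding-∉ u i∉u)))
                                 (rowTerm-extend L u i∉u)

      step : ∀ u → through (suc (suc L)) (M i ∷ i ∷ u) + avoiding L u ≈ 0#
      step u = step′ u (i ∈? toList u)

    Avoiding-long : ∀ L → n ≤ suc (suc L) → Avoiding L ≈ 0#
    Avoiding-long L n≤ = trans (sumVecs-cong {n} (suc L) λ Q → avoiding-vanishes Q λ i∉Q _ path →
                                 ℕ.<-irrefl ≡.refl (ℕ.≤-trans (CoAugPath-length X M pm i∉Q path) n≤))
                               (sumVecs-zero {n} (suc L))

    row-expand : ∑[ k < n ] (h i k * coAugSum R X M α ᾱ k j) ≈ ∑[ L < n ] (Avoiding (toℕ L) + Through (toℕ L))
    row-expand = begin
      ∑[ k < n ] (h i k * coAugSum R X M α ᾱ k j)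
        ≈⟨ sum-cong-≋ {n} (λ k → trans (*-congˡ (coAugSum-expand X M α ᾱ k j))
             (trans (*-distribˡ-sum {n} (h i k) (λ L → sumVecs (suc (toℕ L)) (term k j (toℕ L))))
               (sum-cong-≋ {n} λ L → *-distribˡ-sumVecs (suc (toℕ L)) (h i k) (term k j (toℕ L))))) ⟩
      ∑[ k < n ] ∑[ L < n ] sumVecs (suc (toℕ L)) (λ Q → h i k * term k j (toℕ L) Q)
        ≈⟨ ∑-comm {n} {n} (λ k L → sumVecs (suc (toℕ L)) (λ Q → h i k * term k j (toℕ L) Q)) ⟩
      ∑[ L < n ] ∑[ k < n ] sumVecs (suc (toℕ L)) (λ Q → h i k * term k j (toℕ L) Q)
        ≈⟨ sum-cong-≋ {n} (λ L → sumVecs-head (toℕ L) (λ k Q → h i k * term k j (toℕ L) Q) off-head) ⟩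
      ∑[ L < n ] sumVecs (suc (toℕ L)) (rowTerm (toℕ L))
        ≈⟨ sum-cong-≋ {n} (λ L → trans (sumVecs-cong {n} (suc (toℕ L)) rowTerm-split)
             (sumVecs-distrib-+ (suc (toℕ L)) (avoiding (toℕ L)) (through (toℕ L)))) ⟩
      ∑[ L < n ] (Avoiding (toℕ L) + Through (toℕ L)) ∎
      where
      off-head : ∀ {L} k (Q : Vec (Fin n) (suc L)) → head Q ≢ k → h i k * term k j L Q ≈ 0#
      off-head k Q Q≢k = trans (*-congˡ (reflexive (pathTerm-vanishes X M α ᾱ Q (Q≢k ∘ CoAugPath.head≡)))) (zeroʳ _)

    row-sum : ∑[ k < n ] (h i k * Bmat R X M α ᾱ k j) ≈ δ
    row-sum with Fin-≢⇒n≡2+m i (M i) (proj₁ (proj₂ pm) i ∘ ≡.sym)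
    ... | m , ≡.refl = begin
      ∑[ k < n ] (h i k * Bmat R X M α ᾱ k j)
        ≈⟨ sum-cong-≋ {n} (λ k → *-congˡ {h i k} (Bmat≈coAugSum X M α ᾱ k j)) ⟩
      ∑[ k < n ] (h i k * coAugSum R X M α ᾱ k j)
        ≈⟨ row-expand ⟩
      ∑[ L < n ] (Avoiding (toℕ L) + Through (toℕ L))
        ≈⟨ ∑-telescope m Avoiding Through Through-Avoiding ⟩
      (Through 0 + Through 1) + (Avoiding m + Avoiding (suc m))
        ≈⟨ +-cong (+-cong Through-0 Through-1)
                  (+-cong (Avoiding-long m ℕ.≤-refl) (Avoiding-long (suc m) (ℕ.n≤1+n _))) ⟩
      (0# + δ) + (0# + 0#)
        ≈⟨ +-cong (+-identityˡ δ) (+-identityˡ 0#) ⟩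
      δ + 0#
        ≈⟨ +-identityʳ δ ⟩
      δ ∎

  module _ (α ᾱ : Carrier) (αᾱ≈1 : α * ᾱ ≈ 1#) {n} (X : MixedGraph n) (bipartite : IsBipartite X)
           (M : Fin n → Fin n) (ump : IsUniquePerfectMatching X M) where

    Hα-rightInverse : IsRightInverse R (Hα R X α ᾱ) (Bmat R X M α ᾱ)
    Hα-rightInverse i j = trans (reflexive (sumFin≡sum n _)) (RowIdentity.row-sum α ᾱ αᾱ≈1 X bipartite M ump i j)

    Hα-leftInverse : IsRightInverse R (Bmat R X M α ᾱ) (Hα R X α ᾱ)
    Hα-leftInverse i j = begin
      sumFin R n (λ k → Bmat R X M α ᾱ i k * Hα R X α ᾱ k j)
        ≡⟨ sumFin≡sum n _ ⟩
      ∑[ k < n ] (Bmat R X M α ᾱ i k * Hα R X α ᾱ k j)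
        ≈⟨ sum-cong-≋ {n} (λ k → trans (*-comm _ _)
                                        (*-cong (reflexive (≡.sym (Hα-transpose R X α ᾱ j k))) (transposed k))) ⟩
      ∑[ k < n ] (Hα R (transpose X) α ᾱ j k * Bmat R (transpose X) M α ᾱ k i)
        ≈⟨ RowIdentity.row-sum α ᾱ αᾱ≈1 (transpose X)
             (IsBipartite-resp {X = X} {transpose X} (adj-transpose X) bipartite) M
             (IsUniquePerfectMatching-resp {X = X} {transpose X} (adj-transpose X) ump) j i ⟩
      (if j == i then 1# else 0#)
        ≡⟨ ≡.cong (λ b → if b then 1# else 0#) (==-sym j i) ⟩
      (if i == j then 1# else 0#) ∎
      where
      transposed : ∀ k → Bmat R X M α ᾱ i k ≈ Bmat R (transpose X) M α ᾱ k i
      transposed k = begin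
        Bmat R X M α ᾱ i k               ≈⟨ Bmat≈coAugSum X M α ᾱ i k ⟩
        coAugSum R X M α ᾱ i k           ≈⟨ coAugSum-transpose X M α ᾱ (proj₁ (proj₁ ump)) k i ⟨
        coAugSum R (transpose X) M α ᾱ k i ≈⟨ Bmat≈coAugSum (transpose X) M α ᾱ k i ⟨
        Bmat R (transpose X) M α ᾱ k i   ∎

theorem8 : ∀ {c ℓ} (R : CommutativeRing c ℓ) (C : Conjugation R) →
    let open CommutativeRing R
        open Conjugation C
    in (α : Carrier) → α * conj α ≈ 1# →
       ∀ {n} (X : MixedGraph n) → IsBipartite X →
       (M : Fin n → Fin n) → IsUniquePerfectMatching X M →
       IsRightInverse R (Hα R X α (conj α)) (Bmat R X M α (conj α))
       × IsRightInverse R (Bmat R X M α (conj α)) (Hα R X α (conj α))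
theorem8 R C α αᾱ≈1 X bipartite M ump =
  Hα-rightInverse R α ᾱ αᾱ≈1 X bipartite M ump , Hα-leftInverse R α ᾱ αᾱ≈1 X bipartite M ump
  where ᾱ = Conjugation.conj C α
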